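{- For every edge-weighted connected simple graph $(G,\omega)$ and every spanning tree $T$ of $G$, $$\sum_{e\in E_T}\omega(e)+2\sum_{e\in E_G\setminus E_T}\omega(e)=2\,\omega(G)-\omega(T)\le \mathcal{C}_1(G,T,\omega).$$
   Context: $(G,\omega)$: finite graph $G=(V,E)$ with weights $\omega:E\to(0,\infty)$; $\omega(G)$ and $\omega(T)$ denote the sums of $\omega$ over the edges of $G$ and of $T$ respectively. For a spanning tree $T$ and $e\in E_T$, $\mathcal{C}(G,T,e,\omega)$ is the sum of $\omega(f)$ over edges $f\in E$ with one endpoint in each of the two components of $T$ minus $e$, and $\mathcal{C}_1(G,T,\omega)=\sum_{e\in E_T}\mathcal{C}(G,T,e,\omega)$.
   Formalization: The edge weights take positive rational values rather than values in $(0,\infty)$. -}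

module Defs where

open import Data.Nat using (ℕ; zero; suc; _≤_)
open import Data.Fin using (Fin; zero; suc; _<?_; _≟_)
open import Data.Bool using (Bool; true; false; _∧_; _∨_; not; _xor_; if_then_else_)
open import Data.List using (List; []; _∷_; _++_; length)
open import Data.List.Relation.Unary.Unique.Propositional using (Unique)
open import Data.List.Relation.Unary.Linked using (Linked)
open import Data.Product using (Σ; _×_; ∃-syntax)
open import Data.Rational using (ℚ; 0ℚ; _+_; _<_)
open import Relation.Binary.PropositionalEquality using (_≡_)
open import Relation.Nullary using (¬_)
open import Relation.Nullary.Decidable using (⌊_⌋)
open import Function.Bundles using (_⇔_)

Graph : ℕ → Set
Graph n = Fin n → Fin n → Bool

Adj : ∀ {n} → Graph n → Fin n → Fin n → Set
Adj A x y = A x y ≡ true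

IsSimple : ∀ {n} → Graph n → Set
IsSimple {n} A = (∀ x y → A x y ≡ A y x) × (∀ x → A x x ≡ false)

data Reachable {n} (A : Graph n) : Fin n → Fin n → Set where
  here : ∀ {x} → Reachable A x x
  step : ∀ {x y z} → Adj A x y → Reachable A y z → Reachable A x z

Connected : ∀ {n} → Graph n → Set
Connected {n} A = ∀ (x y : Fin n) → Reachable A x y

-- a cycle: distinct vertices v, w₁, …, wₖ (k ≥ 2) with v ~ w₁ ~ … ~ wₖ ~ v
HasCycle : ∀ {n} → Graph n → Set
HasCycle {n} A =
  ∃[ v ] ∃[ ws ] (2 ≤ length ws × Unique (v ∷ ws) × Linked (Adj A) (v ∷ ws ++ v ∷ []))

Acyclic : ∀ {n} → Graph n → Set
Acyclic A = ¬ HasCycle A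

IsTree : ∀ {n} → Graph n → Set
IsTree A = IsSimple A × Connected A × Acyclic A

IsSpanningTree : ∀ {n} → Graph n → Graph n → Set
IsSpanningTree {n} G T = (∀ (x y : Fin n) → Adj T x y → Adj G x y) × IsTree T

∑ : ∀ {n} → (Fin n → ℚ) → ℚ
∑ {zero} f = 0ℚ
∑ {suc n} f = f zero + ∑ (λ i → f (suc i))

-- sum of f over the edges {x,y} (x < y) of A, each undirected edge once
edgeSum : ∀ {n} → Graph n → (Fin n → Fin n → ℚ) → ℚ
edgeSum A f = ∑ (λ x → ∑ (λ y → if ⌊ x <? y ⌋ ∧ A x y then f x y else 0ℚ))

-- edge weights ω : E → (0,∞) (values on non-edges are irrelevant)
IsWeight : ∀ {n} → Graph n → (Fin n → Fin n → ℚ) → Set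
IsWeight {n} G ω = ∀ (x y : Fin n) → Adj G x y → (0ℚ < ω x y) × (ω x y ≡ ω y x)

removeEdge : ∀ {n} → Graph n → Fin n → Fin n → Graph n
removeEdge T u v x y =
  T x y ∧ not ((⌊ x ≟ u ⌋ ∧ ⌊ y ≟ v ⌋) ∨ (⌊ x ≟ v ⌋ ∧ ⌊ y ≟ u ⌋))

-- side u v : a 2-colouring of the vertices whose colour classes are exactly
-- the connected components of T minus {u,v}, for every tree edge {u,v}
IsComponentLabelling : ∀ {n} → Graph n → (Fin n → Fin n → Fin n → Bool) → Set
IsComponentLabelling {n} T side =
  ∀ (u v : Fin n) → Adj T u v → ∀ (x y : Fin n) →
    (side u v x ≡ side u v y) ⇔ Reachable (removeEdge T u v) x y

-- 𝒞(G,T,e,ω) for e = {u,v}: total weight of edges of G crossing the two components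
𝒞 : ∀ {n} → Graph n → (Fin n → Fin n → Fin n → Bool) → (Fin n → Fin n → ℚ) → Fin n → Fin n → ℚ
𝒞 G side ω u v = edgeSum G (λ x y → if side u v x xor side u v y then ω x y else 0ℚ)

𝒞₁ : ∀ {n} → Graph n → Graph n → (Fin n → Fin n → Fin n → Bool) → (Fin n → Fin n → ℚ) → ℚ
𝒞₁ G T side ω = edgeSum T (λ u v → 𝒞 G side ω u v)

minusGraph : ∀ {n} → Graph n → Graph n → Graph n
minusGraph G T x y = G x y ∧ not (T x y)

-- A tree edge e separates x from y when x and y lie in different components of T − e.
-- Exchanging the order of summation turns 𝒞₁ into the sum, over the edges xy of G, of
-- ω(xy) times the number of tree edges separating x from y. A tree edge xy is separated
-- by itself. For a non-tree edge xy, the first edge of the tree path from x to y and the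
-- first edge of the tree path from y to x both separate x from y, and they are distinct,
-- for otherwise that edge would be xy itself. So 𝒞₁ ≥ ω(T) + 2 ω(G∖T), and the latter
-- equals 2 ω(G) − ω(T) because ω(G) = ω(T) + ω(G∖T).

module Submission where

open import Defs
open import Data.Nat using (ℕ; s≤s; z≤n)
open import Data.Fin using (Fin; zero; suc; _<_; _<?_; _≟_)
open import Data.Fin.Properties using (<-cmp; <⇒≢)
open import Data.Bool using (Bool; true; false; _∧_; not; _xor_; if_then_else_)
open import Data.Bool.Properties using (∧-assoc; ∧-identityʳ; ∧-zeroʳ; ∨-comm)
open import Data.List using (List; []; _∷_; _++_)
open import Data.List.Membership.Propositional using (_∈_)
open import Data.List.Relation.Unary.All using (All; []; _∷_)
open import Data.List.Relation.Unary.All.Properties using (¬Any⇒All¬)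
open import Data.List.Relation.Unary.AllPairs using ([]; _∷_)
open import Data.List.Relation.Unary.Any using (here; there; any?)
open import Data.List.Relation.Unary.Linked using (Linked; [-]; _∷_)
open import Data.List.Relation.Unary.Unique.Propositional using (Unique)
open import Data.Product using (_×_; _,_; ∃-syntax; ∃₂; proj₁; proj₂; uncurry)
open import Data.Sum using (_⊎_; inj₁; inj₂)
open import Data.Rational using (ℚ; 0ℚ; 1ℚ; _+_; _-_; _*_; _≤_)
open import Data.Rational.Properties
  using (≤-refl; ≤-trans; <⇒≤; +-mono-≤; +-monoʳ-≤; +-identityˡ; +-identityʳ; +-comm;
         +-0-commutativeMonoid; module ≤-Reasoning)
open import Data.Rational.Solver using (module +-*-Solver)
open import Algebra.Properties.CommutativeMonoid.Sum +-0-commutativeMonoid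
  using (sum; sum-replicate-zero) renaming (∑-comm to sum-comm; ∑-distrib-+ to sum-distrib-+)
open import Function using (_∘_)
open import Function.Bundles using (Equivalence)
open import Relation.Binary.Definitions using (tri<; tri≈; tri>)
open import Relation.Binary.PropositionalEquality
  using (_≡_; _≢_; refl; sym; trans; cong; cong₂; subst; subst₂; ≢-sym; module ≡-Reasoning)
open import Relation.Nullary using (¬_; yes; no; contradiction)
open import Relation.Nullary.Decidable using (⌊_⌋)

open Equivalence using (to; from)

private
  variable
    k l m n : ℕ
    a b : Bool
    p q : ℚ
    x y z u v w : Fin n
    vs : List (Fin n)
    A B G T : Graph n

∑-cong : {f g : Fin n → ℚ} → (∀ i → f i ≡ g i) → ∑ f ≡ ∑ g
∑-cong {n = ℕ.zero} f≗g = refl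
∑-cong {n = ℕ.suc n} f≗g = cong₂ _+_ (f≗g zero) (∑-cong (f≗g ∘ suc))

∑≡sum : (f : Fin n → ℚ) → ∑ f ≡ sum f
∑≡sum {n = ℕ.zero} f = refl
∑≡sum {n = ℕ.suc n} f = cong (f zero +_) (∑≡sum (f ∘ suc))

∑-zero : ∑ {n} (λ _ → 0ℚ) ≡ 0ℚ
∑-zero {n} = trans (∑≡sum {n} (λ _ → 0ℚ)) (sum-replicate-zero n)

∑-distrib-+ : (f g : Fin n → ℚ) → ∑ (λ i → f i + g i) ≡ ∑ f + ∑ g
∑-distrib-+ f g = begin
  ∑ (λ i → f i + g i)   ≡⟨ ∑≡sum (λ i → f i + g i) ⟩
  sum (λ i → f i + g i) ≡⟨ sum-distrib-+ f g ⟩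
  sum f + sum g         ≡⟨ cong₂ _+_ (∑≡sum f) (∑≡sum g) ⟨
  ∑ f + ∑ g             ∎
  where open ≡-Reasoning

∑-comm : (f : Fin m → Fin n → ℚ) → ∑ (λ i → ∑ (f i)) ≡ ∑ (λ j → ∑ (λ i → f i j))
∑-comm f = begin
  ∑ (λ i → ∑ (f i))              ≡⟨ ∑-cong (λ i → ∑≡sum (f i)) ⟩
  ∑ (λ i → sum (f i))            ≡⟨ ∑≡sum (λ i → sum (f i)) ⟩
  sum (λ i → sum (f i))          ≡⟨ sum-comm f ⟩
  sum (λ j → sum (λ i → f i j))  ≡⟨ ∑≡sum (λ j → sum (λ i → f i j)) ⟨
  ∑ (λ j → sum (λ i → f i j))    ≡⟨ ∑-cong (λ j → ∑≡sum (λ i → f i j)) ⟨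
  ∑ (λ j → ∑ (λ i → f i j))      ∎
  where open ≡-Reasoning

p≤p+q : 0ℚ ≤ q → p ≤ p + q
p≤p+q {q} {p} 0≤q = subst (_≤ p + q) (+-identityʳ p) (+-monoʳ-≤ p 0≤q)

p≤q+p : 0ℚ ≤ q → p ≤ q + p
p≤q+p {q} {p} 0≤q = subst (p ≤_) (+-comm p q) (p≤p+q 0≤q)

∑-mono-≤ : {f g : Fin n → ℚ} → (∀ i → f i ≤ g i) → ∑ f ≤ ∑ g
∑-mono-≤ {n = ℕ.zero} f≤g = ≤-refl
∑-mono-≤ {n = ℕ.suc n} f≤g = +-mono-≤ (f≤g zero) (∑-mono-≤ (f≤g ∘ suc))

∑-nonneg : {f : Fin n → ℚ} → (∀ i → 0ℚ ≤ f i) → 0ℚ ≤ ∑ f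
∑-nonneg {n} {f} f≥0 = subst (_≤ ∑ f) (∑-zero {n}) (∑-mono-≤ f≥0)

∑-≥-term : {f : Fin n → ℚ} → (∀ i → 0ℚ ≤ f i) → ∀ i → f i ≤ ∑ f
∑-≥-term f≥0 zero = p≤p+q (∑-nonneg (f≥0 ∘ suc))
∑-≥-term f≥0 (suc i) = ≤-trans (∑-≥-term (f≥0 ∘ suc) i) (p≤q+p (f≥0 zero))

∑-≥-two-terms : {f : Fin n → ℚ} → (∀ i → 0ℚ ≤ f i) → ∀ {i j} → i ≢ j → f i + f j ≤ ∑ f
∑-≥-two-terms f≥0 {zero} {zero} i≢j = contradiction refl i≢j
∑-≥-two-terms {f = f} f≥0 {zero} {suc j} _ = +-monoʳ-≤ (f zero) (∑-≥-term (f≥0 ∘ suc) j)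
∑-≥-two-terms {f = f} f≥0 {suc i} {zero} i≢j =
  subst (_≤ ∑ f) (+-comm (f zero) (f (suc i))) (∑-≥-two-terms f≥0 (≢-sym i≢j))
∑-≥-two-terms f≥0 {suc i} {suc j} i≢j =
  ≤-trans (∑-≥-two-terms (f≥0 ∘ suc) (i≢j ∘ cong suc)) (p≤q+p (f≥0 zero))

∑² : (Fin m → Fin n → ℚ) → ℚ
∑² F = ∑ (λ i → ∑ (F i))

∑²-cong : {F H : Fin m → Fin n → ℚ} → (∀ i j → F i j ≡ H i j) → ∑² F ≡ ∑² H
∑²-cong F≗H = ∑-cong (∑-cong ∘ F≗H)

∑²-distrib-+ : (F H : Fin m → Fin n → ℚ) → ∑² (λ i j → F i j + H i j) ≡ ∑² F + ∑² H
∑²-distrib-+ F H =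
  trans (∑-cong (λ i → ∑-distrib-+ (F i) (H i))) (∑-distrib-+ (∑ ∘ F) (∑ ∘ H))

∑²-mono-≤ : {F H : Fin m → Fin n → ℚ} → (∀ i j → F i j ≤ H i j) → ∑² F ≤ ∑² H
∑²-mono-≤ F≤H = ∑-mono-≤ (∑-mono-≤ ∘ F≤H)

∑²-comm : (F : Fin k → Fin l → Fin m → Fin n → ℚ) →
          ∑² (λ u v → ∑² (F u v)) ≡ ∑² (λ x y → ∑² (λ u v → F u v x y))
∑²-comm F = begin
  ∑ (λ u → ∑ (λ v → ∑ (λ x → ∑ (F u v x))))
    ≡⟨ ∑-cong (λ u → ∑-comm (λ v x → ∑ (F u v x))) ⟩
  ∑ (λ u → ∑ (λ x → ∑ (λ v → ∑ (F u v x))))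
    ≡⟨ ∑-comm (λ u x → ∑ (λ v → ∑ (F u v x))) ⟩
  ∑ (λ x → ∑ (λ u → ∑ (λ v → ∑ (F u v x))))
    ≡⟨ ∑-cong (λ x → ∑-cong (λ u → ∑-comm (λ v → F u v x))) ⟩
  ∑ (λ x → ∑ (λ u → ∑ (λ y → ∑ (λ v → F u v x y))))
    ≡⟨ ∑-cong (λ x → ∑-comm (λ u y → ∑ (λ v → F u v x y))) ⟩
  ∑ (λ x → ∑ (λ y → ∑ (λ u → ∑ (λ v → F u v x y))))
    ∎
  where open ≡-Reasoning

∑²-≥-term : {F : Fin m → Fin n → ℚ} → (∀ i j → 0ℚ ≤ F i j) → ∀ i j → F i j ≤ ∑² F
∑²-≥-term F≥0 i j = ≤-trans (∑-≥-term (F≥0 i) j) (∑-≥-term (∑-nonneg ∘ F≥0) i)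

∑²-≥-two-terms : {F : Fin m → Fin n → ℚ} → (∀ i j → 0ℚ ≤ F i j) →
                 ∀ {i j k l} → (i , j) ≢ (k , l) → F i j + F k l ≤ ∑² F
∑²-≥-two-terms F≥0 {i} {j} {k} {l} ij≢kl with i ≟ k
... | yes refl = ≤-trans (∑-≥-two-terms (F≥0 i) (ij≢kl ∘ cong (i ,_))) (∑-≥-term (∑-nonneg ∘ F≥0) i)
... | no i≢k = ≤-trans (+-mono-≤ (∑-≥-term (F≥0 i) j) (∑-≥-term (F≥0 k) l))
                       (∑-≥-two-terms (∑-nonneg ∘ F≥0) i≢k)

infixr 7 [_]·_

[_]·_ : Bool → ℚ → ℚ
[ b ]· q = if b then q else 0ℚ

[]·-nonneg : 0ℚ ≤ q → 0ℚ ≤ [ b ]· q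
[]·-nonneg {b = true} 0≤q = 0≤q
[]·-nonneg {b = false} _ = ≤-refl

[]·-mono-≤ : (b ≡ true → p ≤ q) → [ b ]· p ≤ [ b ]· q
[]·-mono-≤ {b = true} p≤q = p≤q refl
[]·-mono-≤ {b = false} _ = ≤-refl

[]·-distrib-+ : ∀ b p q → [ b ]· (p + q) ≡ [ b ]· p + [ b ]· q
[]·-distrib-+ true p q = refl
[]·-distrib-+ false p q = sym (+-identityˡ 0ℚ)

[]·-∧ : ∀ a b q → [ a ∧ b ]· q ≡ [ a ]· [ b ]· q
[]·-∧ true b q = refl
[]·-∧ false b q = refl

[]·-comm : ∀ a b q → [ a ]· [ b ]· q ≡ [ b ]· [ a ]· q
[]·-comm true true q = refl
[]·-comm true false q = refl
[]·-comm false true q = refl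
[]·-comm false false q = refl

[]·+[not]· : ∀ b q → [ b ]· q + [ not b ]· q ≡ q
[]·+[not]· true q = +-identityʳ q
[]·+[not]· false q = +-identityˡ q

[]·-∑ : ∀ b (f : Fin n → ℚ) → [ b ]· ∑ f ≡ ∑ (λ i → [ b ]· f i)
[]·-∑ true f = refl
[]·-∑ {n} false f = sym (∑-zero {n})

[]·-∑² : ∀ b (F : Fin m → Fin n → ℚ) → [ b ]· ∑² F ≡ ∑² (λ i j → [ b ]· F i j)
[]·-∑² b F = trans ([]·-∑ b (∑ ∘ F)) (∑-cong (λ i → []·-∑ b (F i)))

-- edgeSum A f unfolds to ∑² (λ x y → [ edge? A x y ]· f x y).
edge? : Graph n → Fin n → Fin n → Bool
edge? A x y = ⌊ x <? y ⌋ ∧ A x y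

edge?-sound : edge? A x y ≡ true → x < y × Adj A x y
edge?-sound {x = x} {y = y} e with x <? y | e
... | yes x<y | Axy = x<y , Axy
... | no _ | ()

edge?-complete : x < y → Adj A x y → edge? A x y ≡ true
edge?-complete {x = x} {y = y} x<y Axy with x <? y
... | yes _ = Axy
... | no x≮y = contradiction x<y x≮y

edgeSum-cong : {f g : Fin n → Fin n → ℚ} → (∀ x y → f x y ≡ g x y) → edgeSum A f ≡ edgeSum A g
edgeSum-cong {A = A} f≗g = ∑²-cong (λ x y → cong ([ edge? A x y ]·_) (f≗g x y))

edgeSum-distrib-+ : (f g : Fin n → Fin n → ℚ) →
                    edgeSum A (λ x y → f x y + g x y) ≡ edgeSum A f + edgeSum A g
edgeSum-distrib-+ {A = A} f g =
  trans (∑²-cong (λ x y → []·-distrib-+ (edge? A x y) (f x y) (g x y)))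
        (∑²-distrib-+ (λ x y → [ edge? A x y ]· f x y) (λ x y → [ edge? A x y ]· g x y))

edgeSum-∧ : (f : Fin n → Fin n → ℚ) →
            edgeSum (λ x y → A x y ∧ B x y) f ≡ edgeSum A (λ x y → [ B x y ]· f x y)
edgeSum-∧ {A = A} {B = B} f = ∑²-cong λ x y → begin
  [ ⌊ x <? y ⌋ ∧ (A x y ∧ B x y) ]· f x y  ≡⟨ cong ([_]· f x y) (∧-assoc ⌊ x <? y ⌋ (A x y) (B x y)) ⟨
  [ edge? A x y ∧ B x y ]· f x y           ≡⟨ []·-∧ (edge? A x y) (B x y) (f x y) ⟩
  [ edge? A x y ]· [ B x y ]· f x y        ∎
  where open ≡-Reasoning

edgeSum-⊆ : (∀ x y → Adj T x y → Adj G x y) → (f : Fin n → Fin n → ℚ) →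
            edgeSum T f ≡ edgeSum G (λ x y → [ T x y ]· f x y)
edgeSum-⊆ {T = T} {G = G} T⊆G f =
  trans (∑²-cong λ x y → cong (λ b → [ ⌊ x <? y ⌋ ∧ b ]· f x y) (T≡G∧T x y)) (edgeSum-∧ f)
  where
  T≡G∧T : ∀ x y → T x y ≡ G x y ∧ T x y
  T≡G∧T x y with T x y in Txy
  ... | true = sym (trans (∧-identityʳ (G x y)) (T⊆G x y Txy))
  ... | false = sym (∧-zeroʳ (G x y))

edgeSum-split : (∀ x y → Adj T x y → Adj G x y) → (f : Fin n → Fin n → ℚ) →
                edgeSum G f ≡ edgeSum T f + edgeSum (minusGraph G T) f
edgeSum-split {T = T} {G = G} T⊆G f = begin
  edgeSum G f
    ≡⟨ edgeSum-cong (λ x y → []·+[not]· (T x y) (f x y)) ⟨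
  edgeSum G (λ x y → [ T x y ]· f x y + [ not (T x y) ]· f x y)
    ≡⟨ edgeSum-distrib-+ (λ x y → [ T x y ]· f x y) (λ x y → [ not (T x y) ]· f x y) ⟩
  edgeSum G (λ x y → [ T x y ]· f x y) + edgeSum G (λ x y → [ not (T x y) ]· f x y)
    ≡⟨ cong₂ _+_ (edgeSum-⊆ T⊆G f) (edgeSum-∧ f) ⟨
  edgeSum T f + edgeSum (minusGraph G T) f
    ∎
  where open ≡-Reasoning

edgeSum-mono-≤ : {f g : Fin n → Fin n → ℚ} → (∀ {x y} → x < y → Adj A x y → f x y ≤ g x y) →
                 edgeSum A f ≤ edgeSum A g
edgeSum-mono-≤ {A = A} f≤g = ∑²-mono-≤ (λ x y → []·-mono-≤ (uncurry f≤g ∘ edge?-sound {A = A} {x} {y}))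

edgeSum-comm : (F : Fin n → Fin n → Fin n → Fin n → ℚ) →
               edgeSum A (λ u v → edgeSum B (F u v)) ≡ edgeSum B (λ x y → edgeSum A (λ u v → F u v x y))
edgeSum-comm {A = A} {B = B} F = begin
  ∑² (λ u v → [ edge? A u v ]· ∑² (λ x y → [ edge? B x y ]· F u v x y))
    ≡⟨ ∑²-cong (λ u v → []·-∑² (edge? A u v) (λ x y → [ edge? B x y ]· F u v x y)) ⟩
  ∑² (λ u v → ∑² (λ x y → [ edge? A u v ]· [ edge? B x y ]· F u v x y))
    ≡⟨ ∑²-comm (λ u v x y → [ edge? A u v ]· [ edge? B x y ]· F u v x y) ⟩
  ∑² (λ x y → ∑² (λ u v → [ edge? A u v ]· [ edge? B x y ]· F u v x y))
    ≡⟨ ∑²-cong (λ x y → ∑²-cong (λ u v → []·-comm (edge? A u v) (edge? B x y) (F u v x y))) ⟩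
  ∑² (λ x y → ∑² (λ u v → [ edge? B x y ]· [ edge? A u v ]· F u v x y))
    ≡⟨ ∑²-cong (λ x y → []·-∑² (edge? B x y) (λ u v → [ edge? A u v ]· F u v x y)) ⟨
  ∑² (λ x y → [ edge? B x y ]· ∑² (λ u v → [ edge? A u v ]· F u v x y))
    ∎
  where open ≡-Reasoning

edgeSum-≥-edge : {f : Fin n → Fin n → ℚ} → (∀ u v → 0ℚ ≤ f u v) →
                 x < y → Adj A x y → f x y ≤ edgeSum A f
edgeSum-≥-edge {x = x} {y = y} {A = A} {f = f} f≥0 x<y Axy =
  subst (λ b → [ b ]· f x y ≤ edgeSum A f) (edge?-complete {A = A} x<y Axy)
        (∑²-≥-term (λ u v → []·-nonneg (f≥0 u v)) x y)

edgeSum-≥-two-edges : {f : Fin n → Fin n → ℚ} → (∀ u v → 0ℚ ≤ f u v) →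
                      x < y → Adj A x y → u < v → Adj A u v → (x , y) ≢ (u , v) →
                      f x y + f u v ≤ edgeSum A f
edgeSum-≥-two-edges {x = x} {y = y} {A = A} {u = u} {v = v} {f = f} f≥0 x<y Axy u<v Auv xy≢uv =
  subst₂ (λ b c → [ b ]· f x y + [ c ]· f u v ≤ edgeSum A f)
         (edge?-complete {A = A} x<y Axy) (edge?-complete {A = A} u<v Auv)
         (∑²-≥-two-terms (λ u v → []·-nonneg (f≥0 u v)) xy≢uv)

data Path (A : Graph n) : Fin n → Fin n → List (Fin n) → Set where
  []   : Path A x x []
  step : Adj A x y → All (x ≢_) (y ∷ vs) → Path A y z vs → Path A x z (y ∷ vs)

path-suffix : Path A u w vs → x ∈ u ∷ vs → ∃[ ws ] Path A x w ws
path-suffix p (here refl) = _ , p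
path-suffix (step _ _ p) (there x∈vs) = path-suffix p x∈vs

walk⇒path : Reachable A x y → ∃[ vs ] Path A x y vs
walk⇒path here = [] , []
walk⇒path {x = x} (step {y = z} Axz z~y) with walk⇒path z~y
... | vs , p with any? (x ≟_) (z ∷ vs)
...   | yes x∈ = path-suffix p x∈
...   | no x∉ = z ∷ vs , step Axz (¬Any⇒All¬ _ x∉) p

path-mono : (∀ {x y} → Adj A x y → Adj B x y) → Path A x y vs → Path B x y vs
path-mono A⊆B [] = []
path-mono A⊆B (step Axy x∉ p) = step (A⊆B Axy) x∉ (path-mono A⊆B p)

path-unique : Path A x y vs → Unique (x ∷ vs)
path-unique [] = [] ∷ []
path-unique (step _ x∉ p) = x∉ ∷ path-unique p

path-linked : Path A x y vs → Adj A y z → Linked (Adj A) (x ∷ vs ++ z ∷ [])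
path-linked [] Ayz = Ayz ∷ [-]
path-linked (step Axy _ p) Ayz = Axy ∷ path-linked p Ayz

reachable-mono : (∀ {x y} → Adj A x y → Adj B x y) → Reachable A x y → Reachable B x y
reachable-mono A⊆B here = here
reachable-mono A⊆B (step Axy y~z) = step (A⊆B Axy) (reachable-mono A⊆B y~z)

adj⇒≢ : IsSimple A → Adj A x y → x ≢ y
adj⇒≢ (_ , loopless) Axx refl = contradiction (trans (sym Axx) (loopless _)) λ ()

edge-through-both : (∀ x y → A x y ≡ A y x) → Adj A u v → x ≢ y →
                    (x ≡ u ⊎ x ≡ v) → (y ≡ u ⊎ y ≡ v) → Adj A x y
edge-through-both A-sym Auv x≢y (inj₁ refl) (inj₁ refl) = contradiction refl x≢y
edge-through-both A-sym Auv x≢y (inj₁ refl) (inj₂ refl) = Auv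
edge-through-both {u = u} {v = v} A-sym Auv x≢y (inj₂ refl) (inj₁ refl) = trans (A-sym v u) Auv
edge-through-both A-sym Auv x≢y (inj₂ refl) (inj₂ refl) = contradiction refl x≢y

removeEdge-⊆ : Adj (removeEdge A u v) x y → Adj A x y
removeEdge-⊆ {A = A} {x = x} {y = y} e with A x y | e
... | true | _ = refl
... | false | ()

removeEdge-comm : ∀ x y → removeEdge A u v x y ≡ removeEdge A v u x y
removeEdge-comm {A = A} {u = u} {v = v} x y =
  cong (λ b → A x y ∧ not b) (∨-comm (⌊ x ≟ u ⌋ ∧ ⌊ y ≟ v ⌋) (⌊ x ≟ v ⌋ ∧ ⌊ y ≟ u ⌋))

removeEdge-removes : ¬ Adj (removeEdge A u v) u v
removeEdge-removes {A = A} {u = u} {v = v} e with u ≟ u | v ≟ v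
... | yes _ | yes _ = contradiction (trans (sym (∧-zeroʳ (A u v))) e) λ ()
... | no u≢u | _ = u≢u refl
... | _ | no v≢v = v≢v refl

removeEdge-keeps : Adj A y z → x ≢ y → x ≢ z → Adj (removeEdge A x u) y z
removeEdge-keeps {y = y} {z = z} {x = x} {u = u} Ayz x≢y x≢z with y ≟ x | z ≟ x
... | yes y≡x | _ = contradiction (sym y≡x) x≢y
... | no _ | yes z≡x = contradiction (sym z≡x) x≢z
... | no _ | no _ rewrite ∧-zeroʳ ⌊ y ≟ u ⌋ | Ayz = refl

path-avoiding : Path A y z vs → All (x ≢_) (y ∷ vs) → Reachable (removeEdge A x u) y z
path-avoiding [] _ = here
path-avoiding {A = A} {x = x} {u = u} (step Ayw _ p) (x≢y ∷ x∉wvs@(x≢w ∷ _)) =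
  step (removeEdge-keeps {A = A} {u = u} Ayw x≢y x≢w) (path-avoiding p x∉wvs)

first-edge : x ≢ y → Reachable A x y → ∃[ u ] Adj A x u × Reachable (removeEdge A x u) u y
first-edge x≢y x~y with walk⇒path x~y
... | [] , [] = contradiction refl x≢y
... | u ∷ _ , step Axu x∉ p = u , Axu , path-avoiding p x∉

removeEdge-disconnects : IsTree A → Adj A u v → ¬ Reachable (removeEdge A u v) u v
removeEdge-disconnects {A = A} {u = u} {v = v} (simple , _ , acyclic) Auv u~v with walk⇒path u~v
... | [] , [] = adj⇒≢ simple Auv refl
... | _ ∷ [] , step e _ [] = removeEdge-removes {A = A} e
... | vs@(_ ∷ _ ∷ _) , p =
  acyclic (u , vs , s≤s (s≤s z≤n) , path-unique p ,
           path-linked (path-mono (removeEdge-⊆ {A = A} {u = u} {v = v}) p) (trans (proj₁ simple _ u) Auv))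

≢⇒xor≡true : a ≢ b → a xor b ≡ true
≢⇒xor≡true {true} {true} a≢b = contradiction refl a≢b
≢⇒xor≡true {true} {false} _ = refl
≢⇒xor≡true {false} {true} _ = refl
≢⇒xor≡true {false} {false} a≢b = contradiction refl a≢b

-- 𝒞₁ G T side ω unfolds to edgeSum T (λ u v → edgeSum G (λ x y → crossWeight side x y (ω x y) u v)).
crossWeight : (Fin n → Fin n → Fin n → Bool) → Fin n → Fin n → ℚ → Fin n → Fin n → ℚ
crossWeight side x y q u v = [ side u v x xor side u v y ]· q

crossWeight-nonneg : ∀ side → 0ℚ ≤ q → ∀ u v → 0ℚ ≤ crossWeight {n} side x y q u v
crossWeight-nonneg side 0≤q u v = []·-nonneg 0≤q

crossWeight-separating : ∀ side → side u v x ≢ side u v y → crossWeight {n} side x y q u v ≡ q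
crossWeight-separating {q = q} side x≉y = cong ([_]· q) (≢⇒xor≡true x≉y)

module _ {T : Graph n} {side : Fin n → Fin n → Fin n → Bool}
         (tree : IsTree T) (labelling : IsComponentLabelling T side) where

  private
    T-sym : ∀ x y → T x y ≡ T y x
    T-sym = proj₁ (proj₁ tree)

  side-separates : Adj T u v → Reachable (removeEdge T u v) v y → side u v u ≢ side u v y
  side-separates {u = u} {v = v} {y = y} Tuv v~y u≈y =
    removeEdge-disconnects tree Tuv
      (to (labelling u v Tuv u v) (trans u≈y (sym (from (labelling u v Tuv v y) v~y))))

  -- removeEdge T u v and removeEdge T v u are the same graph, so side u v and side v u
  -- have the same colour classes.
  side-separates-flip : Adj T u v → side u v x ≢ side u v y → side v u x ≢ side v u y
  side-separates-flip {u = u} {v = v} {x = x} {y = y} Tuv x≉y x≈y =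
    x≉y (from (labelling u v Tuv x y)
              (reachable-mono (λ {a} {b} → trans (removeEdge-comm {A = T} {u = u} {v = v} a b))
                      (to (labelling v u (trans (T-sym v u) Tuv) x y) x≈y)))

  separating-edge-at : x ≢ y → ∃₂ λ u v → u < v × Adj T u v × (x ≡ u ⊎ x ≡ v) × side u v x ≢ side u v y
  separating-edge-at {x = x} {y = y} x≢y with first-edge x≢y (proj₁ (proj₂ tree) x y)
  ... | w , Txw , w~y with <-cmp x w
  ...   | tri< x<w _ _ = x , w , x<w , Txw , inj₁ refl , side-separates Txw w~y
  ...   | tri≈ _ x≡w _ = contradiction x≡w (adj⇒≢ (proj₁ tree) Txw)
  ...   | tri> _ _ w<x = w , x , w<x , trans (T-sym w x) Txw , inj₂ refl ,
                         side-separates-flip Txw (side-separates Txw w~y)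

  separating-weight-≥ : x < y → 0ℚ ≤ q →
                        q + [ not (T x y) ]· q ≤ edgeSum T (crossWeight side x y q)
  separating-weight-≥ {x = x} {y = y} {q = q} x<y 0≤q with T x y in Txy
  ... | true = begin
    q + 0ℚ                           ≡⟨ +-identityʳ q ⟩
    q                                ≡⟨ crossWeight-separating side (side-separates Txy here) ⟨
    crossWeight side x y q x y       ≤⟨ edgeSum-≥-edge {A = T} (crossWeight-nonneg side 0≤q) x<y Txy ⟩
    edgeSum T (crossWeight side x y q) ∎
    where open ≤-Reasoning
  ... | false with separating-edge-at (<⇒≢ x<y) | separating-edge-at (≢-sym (<⇒≢ x<y))
  ...   | u₁ , v₁ , u₁<v₁ , Tu₁v₁ , x∈e₁ , x≉₁y | u₂ , v₂ , u₂<v₂ , Tu₂v₂ , y∈e₂ , y≉₂x = begin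
    q + q
      ≡⟨ cong₂ _+_ (crossWeight-separating side x≉₁y) (crossWeight-separating side (≢-sym y≉₂x)) ⟨
    crossWeight side x y q u₁ v₁ + crossWeight side x y q u₂ v₂
      ≤⟨ edgeSum-≥-two-edges {A = T} (crossWeight-nonneg side 0≤q) u₁<v₁ Tu₁v₁ u₂<v₂ Tu₂v₂ e₁≢e₂ ⟩
    edgeSum T (crossWeight side x y q)
      ∎
    where
    open ≤-Reasoning
    e₁≢e₂ : (u₁ , v₁) ≢ (u₂ , v₂)
    e₁≢e₂ refl =
      contradiction (trans (sym Txy) (edge-through-both T-sym Tu₁v₁ (<⇒≢ x<y) x∈e₁ y∈e₂)) λ ()

2[a+b]-a≡a+2b : ∀ a b → (1ℚ + 1ℚ) * (a + b) - a ≡ a + (1ℚ + 1ℚ) * b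
2[a+b]-a≡a+2b = solve 2 (λ a b → (con 1ℚ :+ con 1ℚ) :* (a :+ b) :- a := a :+ (con 1ℚ :+ con 1ℚ) :* b) refl
  where open +-*-Solver

2[a+b]-a≡[a+b]+b : ∀ a b → (1ℚ + 1ℚ) * (a + b) - a ≡ (a + b) + b
2[a+b]-a≡[a+b]+b = solve 2 (λ a b → (con 1ℚ :+ con 1ℚ) :* (a :+ b) :- a := (a :+ b) :+ b) refl
  where open +-*-Solver

proposition2p11 : ∀ (n : ℕ) (G T : Graph n) (ω : Fin n → Fin n → ℚ)
    (side : Fin n → Fin n → Fin n → Bool) →
    IsSimple G → Connected G → IsWeight G ω → IsSpanningTree G T →
    IsComponentLabelling T side →
    (edgeSum T ω + (1ℚ + 1ℚ) * edgeSum (minusGraph G T) ω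
        ≡ (1ℚ + 1ℚ) * edgeSum G ω - edgeSum T ω)
    × ((1ℚ + 1ℚ) * edgeSum G ω - edgeSum T ω ≤ 𝒞₁ G T side ω)
proposition2p11 n G T ω side _ _ weight (T⊆G , tree) labelling =
  sym (trans twice-split (2[a+b]-a≡a+2b ω[T] ω[G∖T])) , bound
  where
  ω[T] ω[G∖T] : ℚ
  ω[T] = edgeSum T ω
  ω[G∖T] = edgeSum (minusGraph G T) ω
  twice-split : (1ℚ + 1ℚ) * edgeSum G ω - ω[T] ≡ (1ℚ + 1ℚ) * (ω[T] + ω[G∖T]) - ω[T]
  twice-split = cong (λ g → (1ℚ + 1ℚ) * g - ω[T]) (edgeSum-split T⊆G ω)
  open ≤-Reasoning
  bound : (1ℚ + 1ℚ) * edgeSum G ω - ω[T] ≤ 𝒞₁ G T side ω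
  bound = begin
    (1ℚ + 1ℚ) * edgeSum G ω - ω[T]
      ≡⟨ trans twice-split (2[a+b]-a≡[a+b]+b ω[T] ω[G∖T]) ⟩
    (ω[T] + ω[G∖T]) + ω[G∖T]
      ≡⟨ cong (_+ ω[G∖T]) (edgeSum-split T⊆G ω) ⟨
    edgeSum G ω + ω[G∖T]
      ≡⟨ cong (edgeSum G ω +_) (edgeSum-∧ ω) ⟩
    edgeSum G ω + edgeSum G (λ x y → [ not (T x y) ]· ω x y)
      ≡⟨ edgeSum-distrib-+ ω (λ x y → [ not (T x y) ]· ω x y) ⟨
    edgeSum G (λ x y → ω x y + [ not (T x y) ]· ω x y)
      ≤⟨ edgeSum-mono-≤ (λ x<y Gxy → separating-weight-≥ tree labelling x<y (<⇒≤ (proj₁ (weight _ _ Gxy)))) ⟩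
    edgeSum G (λ x y → edgeSum T (crossWeight side x y (ω x y)))
      ≡⟨ edgeSum-comm (λ u v x y → crossWeight side x y (ω x y) u v) ⟨
    𝒞₁ G T side ω
      ∎
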